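{- For any $a\in\mathbb N$ and any Diophantine logic formula $A$, one can compute $n\le 8|A|$ and an elementary representation of the relation $\nu\mapsto[\![A]\!]\nu$ in the interval $[a,a+n)$.
   Context: Diophantine logic formulas are $A,B::= x_i\doteq n\mid x_i\doteq x_j\mid x_i\doteq x_j\dot+x_k\mid x_i\doteq x_j\dot\times x_k\mid A\dot\wedge B\mid A\dot\vee B\mid\dot\exists A$, with De Bruijn indices. For $\nu:\mathbb N\to\mathbb N$ the semantics is as follows. - Atoms have their obvious meaning, e.g. $[\![x_i\doteq x_j\dot\times x_k]\!]\nu\iff\nu(i)=\nu(j)\nu(k)$. - $\dot\wedge$ and $\dot\vee$ are interpreted as $\wedge$ and $\vee$. - $[\![\dot\exists A]\!]\nu\iff\exists n,\ [\![A]\!](n\cdot\nu)$, with $(n\cdot\nu)(0)=n$ and $(n\cdot\nu)(i+1)=\nu(i)$. $|A|$ denotes the number of nodes of the syntax tree of $A$. Elementary constraints are $u\doteq n$, $u\doteq v$, $u\doteq x_i$, $u\doteq v\dot+w$ and $u\doteq v\dot\times w$, with existential variables $u,v,w\in\mathbb N$ and parameters $x_i$. Under $\varphi$ (variables) and $\nu$ (parameters) they mean, respectively: $\varphi(u)=n$, $\varphi(u)=\varphi(v)$, $\varphi(u)=\nu(i)$, $\varphi(u)=\varphi(v)+\varphi(w)$ and $\varphi(u)=\varphi(v)\varphi(w)$. $[\![E]\!]^\varphi_\nu$ means all constraints in the list $E$ hold. An elementary representation of $R:(\mathbb N\to\mathbb N)\to\mathrm{Prop}$ in $[a,a+n)$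 consists of a list $E$ of constraints and a reference variable $r\in\mathbb N$ satisfying the following. 1. $r$ and all existential variables occurring in $E$ lie in $[a,a+n)$. 2. For all $\nu$ there is $\varphi$ with $[\![E]\!]^\varphi_\nu$. 3. For all $\nu$, $R\,\nu\iff\exists\varphi,\ \varphi(r)=0\wedge[\![E]\!]^\varphi_\nu$. -}

module Defs where

open import Data.Nat using (ℕ; zero; suc; _+_; _*_; _≤_; _<_)
open import Data.List using (List)
open import Data.List.Relation.Unary.All using (All)
open import Data.Product using (_×_; ∃)
open import Data.Sum using (_⊎_)
open import Data.Unit using (⊤)
open import Level using (0ℓ)
open import Relation.Binary.PropositionalEquality using (_≡_)

-- Diophantine logic formulas (De Bruijn indices for x_i)
data Form : Set where
  cst  : ℕ → ℕ → Form
  eqv  : ℕ → ℕ → Form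
  add  : ℕ → ℕ → ℕ → Form
  mul  : ℕ → ℕ → ℕ → Form
  conj : Form → Form → Form
  disj : Form → Form → Form
  ex   : Form → Form

_·_ : ℕ → (ℕ → ℕ) → (ℕ → ℕ)
(n · ν) zero    = n
(n · ν) (suc i) = ν i

⟦_⟧ : Form → (ℕ → ℕ) → Set
⟦ cst i n ⟧ ν   = ν i ≡ n
⟦ eqv i j ⟧ ν   = ν i ≡ ν j
⟦ add i j k ⟧ ν = ν i ≡ ν j + ν k
⟦ mul i j k ⟧ ν = ν i ≡ ν j * ν k
⟦ conj A B ⟧ ν  = ⟦ A ⟧ ν × ⟦ B ⟧ ν
⟦ disj A B ⟧ ν  = ⟦ A ⟧ ν ⊎ ⟦ B ⟧ ν
⟦ ex A ⟧ ν      = ∃ λ n → ⟦ A ⟧ (n · ν)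

size : Form → ℕ
size (cst _ _)   = 1
size (eqv _ _)   = 1
size (add _ _ _) = 1
size (mul _ _ _) = 1
size (conj A B)  = suc (size A + size B)
size (disj A B)  = suc (size A + size B)
size (ex A)      = suc (size A)

data Constr : Set where
  ecst : ℕ → ℕ → Constr
  evar : ℕ → ℕ → Constr
  epar : ℕ → ℕ → Constr
  eadd : ℕ → ℕ → ℕ → Constr
  emul : ℕ → ℕ → ℕ → Constr

⟦_⟧ᶜ : Constr → (ℕ → ℕ) → (ℕ → ℕ) → Set
⟦ ecst u n ⟧ᶜ φ ν   = φ u ≡ n
⟦ evar u v ⟧ᶜ φ ν   = φ u ≡ φ v
⟦ epar u i ⟧ᶜ φ ν   = φ u ≡ ν i
⟦ eadd u v w ⟧ᶜ φ ν = φ u ≡ φ v + φ w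
⟦ emul u v w ⟧ᶜ φ ν = φ u ≡ φ v * φ w

⟦_⟧ᴱ : List Constr → (ℕ → ℕ) → (ℕ → ℕ) → Set
⟦ E ⟧ᴱ φ ν = All (λ c → ⟦ c ⟧ᶜ φ ν) E

InInterval : ℕ → ℕ → ℕ → Set
InInterval a n u = a ≤ u × u < a + n

VarsIn : ℕ → ℕ → Constr → Set
VarsIn a n (ecst u _)   = InInterval a n u
VarsIn a n (evar u v)   = InInterval a n u × InInterval a n v
VarsIn a n (epar u _)   = InInterval a n u
VarsIn a n (eadd u v w) = InInterval a n u × InInterval a n v × InInterval a n w
VarsIn a n (emul u v w) = InInterval a n u × InInterval a n v × InInterval a n w

record ElemRep (R : (ℕ → ℕ) → Set) (a n : ℕ) (E : List Constr) (r : ℕ) : Set₁ where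
  field
    ref-in   : InInterval a n r
    vars-in  : All (VarsIn a n) E
    total    : ∀ ν → ∃ λ φ → ⟦ E ⟧ᴱ φ ν
    correct  : ∀ ν → (R ν → ∃ λ φ → φ r ≡ 0 × ⟦ E ⟧ᴱ φ ν)
                   × ((∃ λ φ → φ r ≡ 0 × ⟦ E ⟧ᴱ φ ν) → R ν)

-- Each formula is compiled into constraints on a block of fresh variables together with a
-- reference variable that can be made 0 exactly when the formula holds. An atom p ≐ q
-- computes p and q and then the slack d + e of p + d = q + e; a conjunction takes the sum
-- and a disjunction the product of the two reference variables; ∃̇ turns the parameter x₀
-- into one more variable. The blocks of subformulas are disjoint, so solutions for them glue
-- into one valuation. An atom needs at most 8 variables and every connective only one more.
module Submission where

open import Defs
open import Data.Nat using (ℕ; zero; suc; _+_; _*_; _∸_; _≤_; _<_; _<?_; _<ᵇ_; z≤n; s≤s; z<s)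
open import Data.Nat.Properties
open import Data.List using (List; []; _∷_; _++_; map)
open import Data.List.Relation.Unary.All as All using (All; []; _∷_)
open import Data.List.Relation.Unary.All.Properties using (++⁺; ++⁻; map⁺; map⁻)
open import Data.Product using (Σ; _×_; _,_; ∃; ∃₂; proj₁; proj₂)
open import Data.Sum using (_⊎_; inj₁; inj₂)
open import Data.Bool using (T)
open import Function using (id)
open import Relation.Nullary using (yes; no; contradiction)
open import Relation.Binary.PropositionalEquality

private variable
  a b m n k i r u v w x y z s t : ℕ
  φ ψ ν : ℕ → ℕ
  c : Constr
  E E₁ E₂ : List Constr
  R S : (ℕ → ℕ) → Set
  f g : (ℕ → ℕ) → ℕ

glue : ℕ → (ℕ → ℕ) → (ℕ → ℕ) → ℕ → ℕ
glue b φ ψ u with u <? b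
... | yes _ = φ u
... | no  _ = ψ u

glue-< : ∀ φ ψ → u < b → glue b φ ψ u ≡ φ u
glue-< {u = u} {b = b} φ ψ u<b with u <? b
... | yes _   = refl
... | no  u≮b = contradiction u<b u≮b

glue-≥ : ∀ φ ψ → b ≤ u → glue b φ ψ u ≡ ψ u
glue-≥ {b = b} {u = u} φ ψ b≤u with u <? b
... | yes u<b = contradiction b≤u (<⇒≱ u<b)
... | no  _   = refl

InInterval-⊆ : a ≤ b → b + m ≤ a + n → InInterval b m u → InInterval a n u
InInterval-⊆ a≤b b+m≤a+n (b≤u , u<b+m) = ≤-trans a≤b b≤u , <-≤-trans u<b+m b+m≤a+n

InInterval-≤ : m ≤ n → InInterval a m u → InInterval a n u
InInterval-≤ {a = a} m≤n = InInterval-⊆ ≤-refl (+-monoʳ-≤ a m≤n)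

InInterval-+ : InInterval (a + m) k u → InInterval a (m + k) u
InInterval-+ {a = a} {m = m} {k = k} = InInterval-⊆ (m≤m+n a m) (≤-reflexive (+-assoc a m k))

InInterval-fresh : i < k → InInterval a (n + k) (i + (a + n))
InInterval-fresh {i = i} {k = k} {a = a} {n = n} i<k =
  ≤-trans (m≤m+n a n) (m≤n+m (a + n) i) ,
  <-≤-trans (+-monoˡ-< (a + n) i<k) (≤-reflexive (trans (+-comm k (a + n)) (+-assoc a n k)))

VarsIn-map : (∀ {u} → InInterval a n u → InInterval b m u) → VarsIn a n c → VarsIn b m c
VarsIn-map {c = ecst _ _}   f u∈             = f u∈
VarsIn-map {c = evar _ _}   f (u∈ , v∈)      = f u∈ , f v∈
VarsIn-map {c = epar _ _}   f u∈             = f u∈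
VarsIn-map {c = eadd _ _ _} f (u∈ , v∈ , w∈) = f u∈ , f v∈ , f w∈
VarsIn-map {c = emul _ _ _} f (u∈ , v∈ , w∈) = f u∈ , f v∈ , f w∈

⟦⟧ᶜ-cong : (∀ {u} → InInterval a n u → φ u ≡ ψ u) → VarsIn a n c → ⟦ c ⟧ᶜ φ ν → ⟦ c ⟧ᶜ ψ ν
⟦⟧ᶜ-cong {c = ecst _ _}   eq u∈             h = trans (sym (eq u∈)) h
⟦⟧ᶜ-cong {c = evar _ _}   eq (u∈ , v∈)      h = trans (sym (eq u∈)) (trans h (eq v∈))
⟦⟧ᶜ-cong {c = epar _ _}   eq u∈             h = trans (sym (eq u∈)) h
⟦⟧ᶜ-cong {c = eadd _ _ _} eq (u∈ , v∈ , w∈) h =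
  trans (sym (eq u∈)) (trans h (cong₂ _+_ (eq v∈) (eq w∈)))
⟦⟧ᶜ-cong {c = emul _ _ _} eq (u∈ , v∈ , w∈) h =
  trans (sym (eq u∈)) (trans h (cong₂ _*_ (eq v∈) (eq w∈)))

⟦⟧ᴱ-cong : (∀ {u} → InInterval a n u → φ u ≡ ψ u) → All (VarsIn a n) E → ⟦ E ⟧ᴱ φ ν → ⟦ E ⟧ᴱ ψ ν
⟦⟧ᴱ-cong eq E∈ h = All.zipWith (λ (c∈ , hc) → ⟦⟧ᶜ-cong eq c∈ hc) (E∈ , h)

glue-inside : ∀ φ ψ → InInterval a n u → glue (a + n) φ ψ u ≡ φ u
glue-inside φ ψ (_ , u<) = glue-< φ ψ u<

⟦⟧ᴱ-glueˡ : ∀ ψ → All (VarsIn a n) E → ⟦ E ⟧ᴱ φ ν → ⟦ E ⟧ᴱ (glue (a + n) φ ψ) ν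
⟦⟧ᴱ-glueˡ {φ = φ} ψ = ⟦⟧ᴱ-cong (λ u∈ → sym (glue-inside φ ψ u∈))

⟦⟧ᴱ-glueʳ : ∀ φ → All (VarsIn b k) E → ⟦ E ⟧ᴱ ψ ν → ⟦ E ⟧ᴱ (glue b φ ψ) ν
⟦⟧ᴱ-glueʳ {ψ = ψ} φ = ⟦⟧ᴱ-cong (λ (b≤u , _) → sym (glue-≥ φ ψ b≤u))

Solvable : List Constr → (ℕ → ℕ) → Set
Solvable E ν = ∃ λ φ → ⟦ E ⟧ᴱ φ ν

Attains : List Constr → ℕ → (ℕ → ℕ) → ℕ → Set
Attains E u ν x = ∃ λ φ → φ u ≡ x × ⟦ E ⟧ᴱ φ ν

Attains₂ : List Constr → ℕ → ℕ → (ℕ → ℕ) → ℕ → ℕ → Set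
Attains₂ E u v ν x y = ∃ λ φ → φ u ≡ x × φ v ≡ y × ⟦ E ⟧ᴱ φ ν

Attains⇒Solvable : Attains E u ν x → Solvable E ν
Attains⇒Solvable (φ , _ , h) = φ , h

Solvable⇒Attains : Solvable E ν → ∃ (Attains E u ν)
Solvable⇒Attains {u = u} (φ , h) = φ u , φ , refl , h

Attains₂-++⁺ : All (VarsIn a m) E₁ → InInterval a m u →
               All (VarsIn (a + m) k) E₂ → InInterval (a + m) k v →
               Attains E₁ u ν x → Attains E₂ v ν y → Attains₂ (E₁ ++ E₂) u v ν x y
Attains₂-++⁺ {a = a} {m = m} E₁∈ u∈ E₂∈ (a+m≤v , _) (φ , φu , h₁) (ψ , ψv , h₂) =
  glue (a + m) φ ψ ,
  trans (glue-inside φ ψ u∈) φu ,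
  trans (glue-≥ φ ψ a+m≤v) ψv ,
  ++⁺ (⟦⟧ᴱ-glueˡ ψ E₁∈ h₁) (⟦⟧ᴱ-glueʳ φ E₂∈ h₂)

Attains₂-++⁻ : ∀ E₁ → Attains₂ (E₁ ++ E₂) u v ν x y → Attains E₁ u ν x × Attains E₂ v ν y
Attains₂-++⁻ E₁ (φ , φu , φv , h) = let (h₁ , h₂) = ++⁻ E₁ h in (φ , φu , h₁) , (φ , φv , h₂)

++-VarsIn : All (VarsIn a m) E₁ → All (VarsIn (a + m) k) E₂ → All (VarsIn a (m + k)) (E₁ ++ E₂)
++-VarsIn {m = m} {k = k} E₁∈ E₂∈ =
  ++⁺ (All.map (VarsIn-map (InInterval-≤ (m≤m+n m k))) E₁∈) (All.map (VarsIn-map InInterval-+) E₂∈)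

data Op : Set where
  plus times : Op

⟦_⟧ᵒ : Op → ℕ → ℕ → ℕ
⟦ plus  ⟧ᵒ = _+_
⟦ times ⟧ᵒ = _*_

opConstr : Op → ℕ → ℕ → ℕ → Constr
opConstr plus  = eadd
opConstr times = emul

opConstr-sem : ∀ o → ⟦ opConstr o u v w ⟧ᶜ φ ν ≡ (φ u ≡ ⟦ o ⟧ᵒ (φ v) (φ w))
opConstr-sem plus  = refl
opConstr-sem times = refl

opConstr-VarsIn : ∀ o → InInterval a n u → InInterval a n v → InInterval a n w →
                  VarsIn a n (opConstr o u v w)
opConstr-VarsIn plus  u∈ v∈ w∈ = u∈ , v∈ , w∈
opConstr-VarsIn times u∈ v∈ w∈ = u∈ , v∈ , w∈

op-VarsIn : ∀ o → All (VarsIn a n) E → InInterval a n u → InInterval a n v →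
            All (VarsIn a (n + 1)) (E ++ opConstr o (a + n) u v ∷ [])
op-VarsIn {a = a} {n = n} o E∈ u∈ v∈ =
  ++⁺ (All.map (VarsIn-map old) E∈) (opConstr-VarsIn o (InInterval-fresh z<s) (old u∈) (old v∈) ∷ [])
  where
  old : InInterval a n w → InInterval a (n + 1) w
  old = InInterval-≤ (m≤m+n n 1)

Attains-op⁺ : ∀ o → All (VarsIn a n) E → InInterval a n u → InInterval a n v →
              Attains₂ E u v ν x y → Attains (E ++ opConstr o (a + n) u v ∷ []) (a + n) ν (⟦ o ⟧ᵒ x y)
Attains-op⁺ {a = a} {n = n} {u = u} {v = v} {x = x} {y = y} o E∈ u∈ v∈ (φ , φu , φv , h) =
  χ , fresh , ++⁺ (⟦⟧ᴱ-glueˡ _ E∈ h) (subst id (sym (opConstr-sem o)) χr ∷ [])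
  where
  χ = glue (a + n) φ (λ _ → ⟦ o ⟧ᵒ x y)
  fresh : χ (a + n) ≡ ⟦ o ⟧ᵒ x y
  fresh = glue-≥ {b = a + n} φ _ ≤-refl
  χr : χ (a + n) ≡ ⟦ o ⟧ᵒ (χ u) (χ v)
  χr = trans fresh (sym (cong₂ ⟦ o ⟧ᵒ (trans (glue-inside φ _ u∈) φu) (trans (glue-inside φ _ v∈) φv)))

Attains-op⁻ : ∀ o E → Attains (E ++ opConstr o r u v ∷ []) r ν z →
              ∃₂ λ x y → z ≡ ⟦ o ⟧ᵒ x y × Attains₂ E u v ν x y
Attains-op⁻ {u = u} {v = v} o E (φ , φr , h) with ++⁻ E h
... | hE , hc ∷ [] = φ u , φ v , trans (sym φr) (subst id (opConstr-sem o) hc) , φ , refl , refl , hE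

-- Writing d = φ b and e = φ (1 + b), the constraints say u + d = v + e and r = d + e with
-- r = 3 + b: so r = 0 forces u = v, while d = v ∸ u and e = u ∸ v always solve them.
eqGadget : ℕ → ℕ → ℕ → List Constr
eqGadget b u v = eadd (2 + b) u b ∷ eadd (2 + b) v (1 + b) ∷ eadd (3 + b) b (1 + b) ∷ []

eqGadgetVal : ℕ → ℕ → ℕ → ℕ
eqGadgetVal p q 0 = q ∸ p
eqGadgetVal p q 1 = p ∸ q
eqGadgetVal p q 2 = p + (q ∸ p)
eqGadgetVal p q _ = (q ∸ p) + (p ∸ q)

m+[n∸m]≡n+[m∸n] : ∀ m n → m + (n ∸ m) ≡ n + (m ∸ n)
m+[n∸m]≡n+[m∸n] zero    zero    = refl
m+[n∸m]≡n+[m∸n] zero    (suc n) = sym (+-identityʳ (suc n))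
m+[n∸m]≡n+[m∸n] (suc m) zero    = +-identityʳ (suc m)
m+[n∸m]≡n+[m∸n] (suc m) (suc n) = cong suc (m+[n∸m]≡n+[m∸n] m n)

eqGadget-VarsIn : All (VarsIn a n) E → InInterval a n u → InInterval a n v →
                  All (VarsIn a (n + 4)) (E ++ eqGadget (a + n) u v)
eqGadget-VarsIn {a = a} {n = n} E∈ u∈ v∈ =
  ++⁺ (All.map (VarsIn-map old) E∈)
      ((new 2 , old u∈ , new 0) ∷ (new 2 , old v∈ , new 1) ∷ (new 3 , new 0 , new 1) ∷ [])
  where
  old : InInterval a n w → InInterval a (n + 4) w
  old = InInterval-≤ (m≤m+n n 4)
  new : ∀ i {i<4 : T (i <ᵇ 4)} → InInterval a (n + 4) (i + (a + n))
  new i {i<4} = InInterval-fresh (<ᵇ⇒< i 4 i<4)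

Attains-eqGadget⁺ : All (VarsIn a n) E → InInterval a n u → InInterval a n v → Attains₂ E u v ν x y →
                    Attains (E ++ eqGadget (a + n) u v) (3 + (a + n)) ν ((y ∸ x) + (x ∸ y))
Attains-eqGadget⁺ {a = a} {n = n} {u = u} {v = v} {x = x} {y = y} E∈ u∈ v∈ (φ , φu , φv , h) =
  χ , new 3 ,
  ++⁺ (⟦⟧ᴱ-glueˡ _ E∈ h)
      ( trans (new 2) (cong₂ _+_ (sym χu) (sym (new 0)))
      ∷ trans (new 2) (trans (m+[n∸m]≡n+[m∸n] x y) (cong₂ _+_ (sym χv) (sym (new 1))))
      ∷ trans (new 3) (cong₂ _+_ (sym (new 0)) (sym (new 1)))
      ∷ [])
  where
  χ = glue (a + n) φ (λ w → eqGadgetVal x y (w ∸ (a + n)))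
  new : ∀ i → χ (i + (a + n)) ≡ eqGadgetVal x y i
  new i = trans (glue-≥ {b = a + n} φ _ (m≤n+m (a + n) i)) (cong (eqGadgetVal x y) (m+n∸n≡m i (a + n)))
  χu : χ u ≡ x
  χu = trans (glue-inside φ _ u∈) φu
  χv : χ v ≡ y
  χv = trans (glue-inside φ _ v∈) φv

Attains-eqGadget⁻ : ∀ E → Attains (E ++ eqGadget b u v) (3 + b) ν 0 → ∃ λ x → Attains₂ E u v ν x x
Attains-eqGadget⁻ {b = b} {u = u} {v = v} E (φ , φr , h) with ++⁻ E h
... | hE , u+d ∷ v+e ∷ d+e ∷ [] = φ u , φ , refl , φv≡φu , hE
  where
  open ≡-Reasoning
  d+e≡0 : φ b + φ (1 + b) ≡ 0
  d+e≡0 = trans (sym d+e) φr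
  φv≡φu : φ v ≡ φ u
  φv≡φu = begin
    φ v             ≡⟨ sym (+-identityʳ (φ v)) ⟩
    φ v + 0         ≡⟨ cong (φ v +_) (sym (m+n≡0⇒n≡0 (φ b) d+e≡0)) ⟩
    φ v + φ (1 + b) ≡⟨ trans (sym v+e) u+d ⟩
    φ u + φ b       ≡⟨ cong (φ u +_) (m+n≡0⇒m≡0 (φ b) d+e≡0) ⟩
    φ u + 0         ≡⟨ +-identityʳ (φ u) ⟩
    φ u             ∎

module Juxtaposed {a m k : ℕ} {E₁ E₂ : List Constr} {u v : ℕ}
  (E₁∈ : All (VarsIn a m) E₁) (u∈ : InInterval a m u)
  (E₂∈ : All (VarsIn (a + m) k) E₂) (v∈ : InInterval (a + m) k v) where

  private
    E∈ : All (VarsIn a (m + k)) (E₁ ++ E₂)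
    E∈ = ++-VarsIn E₁∈ E₂∈

    u∈′ : InInterval a (m + k) u
    u∈′ = InInterval-≤ (m≤m+n m k) u∈

    v∈′ : InInterval a (m + k) v
    v∈′ = InInterval-+ v∈

    pair⁺ : Attains E₁ u ν x → Attains E₂ v ν y → Attains₂ (E₁ ++ E₂) u v ν x y
    pair⁺ = Attains₂-++⁺ E₁∈ u∈ E₂∈ v∈

  ⊕-system : Op → List Constr
  ⊕-system o = (E₁ ++ E₂) ++ opConstr o (a + (m + k)) u v ∷ []

  ⊕-VarsIn : ∀ o → All (VarsIn a (m + k + 1)) (⊕-system o)
  ⊕-VarsIn o = op-VarsIn o E∈ u∈′ v∈′

  ⊕⁺ : ∀ o → Attains E₁ u ν x → Attains E₂ v ν y → Attains (⊕-system o) (a + (m + k)) ν (⟦ o ⟧ᵒ x y)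
  ⊕⁺ o A B = Attains-op⁺ o E∈ u∈′ v∈′ (pair⁺ A B)

  ⊕⁻ : ∀ o → Attains (⊕-system o) (a + (m + k)) ν z →
       ∃₂ λ x y → z ≡ ⟦ o ⟧ᵒ x y × Attains E₁ u ν x × Attains E₂ v ν y
  ⊕⁻ o h = let (x , y , z≡ , P) = Attains-op⁻ o (E₁ ++ E₂) h in x , y , z≡ , Attains₂-++⁻ E₁ P

  ≐-system : List Constr
  ≐-system = (E₁ ++ E₂) ++ eqGadget (a + (m + k)) u v

  ≐-VarsIn : All (VarsIn a (m + k + 4)) ≐-system
  ≐-VarsIn = eqGadget-VarsIn E∈ u∈′ v∈′

  ≐⁺ : Attains E₁ u ν x → Attains E₂ v ν y → Attains ≐-system (3 + (a + (m + k))) ν ((y ∸ x) + (x ∸ y))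
  ≐⁺ A B = Attains-eqGadget⁺ E∈ u∈′ v∈′ (pair⁺ A B)

  ≐⁻ : Attains ≐-system (3 + (a + (m + k))) ν 0 → ∃ λ x → Attains E₁ u ν x × Attains E₂ v ν x
  ≐⁻ h = let (x , P) = Attains-eqGadget⁻ (E₁ ++ E₂) h in x , Attains₂-++⁻ E₁ P

open ElemRep

ElemRep-attains : ElemRep R a n E r → ∀ ν → ∃ (Attains E r ν)
ElemRep-attains I ν = Solvable⇒Attains (total I ν)

ElemRep-complete : ElemRep R a n E r → R ν → Attains E r ν 0
ElemRep-complete I = proj₁ (correct I _)

ElemRep-sound : ElemRep R a n E r → Attains E r ν 0 → R ν
ElemRep-sound I = proj₂ (correct I _)

conj-rep : ElemRep R a m E₁ u → ElemRep S (a + m) k E₂ v →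
           ElemRep (λ ν → R ν × S ν) a (m + k + 1)
                   ((E₁ ++ E₂) ++ opConstr plus (a + (m + k)) u v ∷ []) (a + (m + k))
conj-rep {R = R} {a = a} {m = m} {S = S} {k = k} IA IB = record
  { ref-in  = InInterval-fresh z<s
  ; vars-in = ⊕-VarsIn plus
  ; total   = λ ν → Attains⇒Solvable
                     (⊕⁺ plus (proj₂ (ElemRep-attains IA ν)) (proj₂ (ElemRep-attains IB ν)))
  ; correct = λ ν → (λ (p , q) → ⊕⁺ plus (ElemRep-complete IA p) (ElemRep-complete IB q)) , sound
  }
  where
  open Juxtaposed (vars-in IA) (ref-in IA) (vars-in IB) (ref-in IB)
  sound : Attains (⊕-system plus) (a + (m + k)) ν 0 → R ν × S ν
  sound h with ⊕⁻ plus h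
  ... | x , _ , 0≡x+y , A , B =
    ElemRep-sound IA (subst (Attains _ _ _) (m+n≡0⇒m≡0 x (sym 0≡x+y)) A) ,
    ElemRep-sound IB (subst (Attains _ _ _) (m+n≡0⇒n≡0 x (sym 0≡x+y)) B)

disj-rep : ElemRep R a m E₁ u → ElemRep S (a + m) k E₂ v →
           ElemRep (λ ν → R ν ⊎ S ν) a (m + k + 1)
                   ((E₁ ++ E₂) ++ opConstr times (a + (m + k)) u v ∷ []) (a + (m + k))
disj-rep {R = R} {a = a} {m = m} {S = S} {k = k} IA IB = record
  { ref-in  = InInterval-fresh z<s
  ; vars-in = ⊕-VarsIn times
  ; total   = λ ν → Attains⇒Solvable
                     (⊕⁺ times (proj₂ (ElemRep-attains IA ν)) (proj₂ (ElemRep-attains IB ν)))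
  ; correct = λ ν → complete , sound
  }
  where
  open Juxtaposed (vars-in IA) (ref-in IA) (vars-in IB) (ref-in IB)
  complete : R ν ⊎ S ν → Attains (⊕-system times) (a + (m + k)) ν 0
  complete {ν} (inj₁ p) = ⊕⁺ times (ElemRep-complete IA p) (proj₂ (ElemRep-attains IB ν))
  complete {ν} (inj₂ q) with ElemRep-attains IA ν
  ... | x , A = subst (Attains _ _ ν) (*-zeroʳ x) (⊕⁺ times A (ElemRep-complete IB q))
  sound : Attains (⊕-system times) (a + (m + k)) ν 0 → R ν ⊎ S ν
  sound h with ⊕⁻ times h
  ... | x , _ , 0≡x*y , A , B with m*n≡0⇒m≡0∨n≡0 x (sym 0≡x*y)
  ... | inj₁ x≡0 = inj₁ (ElemRep-sound IA (subst (Attains _ _ _) x≡0 A))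
  ... | inj₂ y≡0 = inj₂ (ElemRep-sound IB (subst (Attains _ _ _) y≡0 B))

record TermRep (f : (ℕ → ℕ) → ℕ) (a n : ℕ) (E : List Constr) (r : ℕ) : Set where
  field
    ref-in    : InInterval a n r
    vars-in   : All (VarsIn a n) E
    evaluates : ∀ ν → Attains E r ν (f ν)
    unique    : ∀ {ν x} → Attains E r ν x → x ≡ f ν

open TermRep

InInterval-base : InInterval a 1 a
InInterval-base {a} = ≤-refl , m<m+n a z<s

param-term : ∀ a i → TermRep (λ ν → ν i) a 1 (epar a i ∷ []) a
param-term a i = record
  { ref-in    = InInterval-base
  ; vars-in   = InInterval-base ∷ []
  ; evaluates = λ ν → (λ _ → ν i) , refl , refl ∷ []
  ; unique    = λ { (_ , φa , φa≡νi ∷ []) → trans (sym φa) φa≡νi }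
  }

const-term : ∀ a k → TermRep (λ _ → k) a 1 (ecst a k ∷ []) a
const-term a k = record
  { ref-in    = InInterval-base
  ; vars-in   = InInterval-base ∷ []
  ; evaluates = λ ν → (λ _ → k) , refl , refl ∷ []
  ; unique    = λ { (_ , φa , φa≡k ∷ []) → trans (sym φa) φa≡k }
  }

op-term : ∀ o → TermRep f a m E₁ u → TermRep g (a + m) k E₂ v →
          TermRep (λ ν → ⟦ o ⟧ᵒ (f ν) (g ν)) a (m + k + 1)
                  ((E₁ ++ E₂) ++ opConstr o (a + (m + k)) u v ∷ []) (a + (m + k))
op-term o T₁ T₂ = record
  { ref-in    = InInterval-fresh z<s
  ; vars-in   = ⊕-VarsIn o
  ; evaluates = λ ν → ⊕⁺ o (evaluates T₁ ν) (evaluates T₂ ν)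
  ; unique    = λ h → let (_ , _ , z≡ , A , B) = ⊕⁻ o h in
                      trans z≡ (cong₂ ⟦ o ⟧ᵒ (unique T₁ A) (unique T₂ B))
  }
  where open Juxtaposed (vars-in T₁) (ref-in T₁) (vars-in T₂) (ref-in T₂)

eq-rep : TermRep f a m E₁ u → TermRep g (a + m) k E₂ v →
         ElemRep (λ ν → f ν ≡ g ν) a (m + k + 4)
                 ((E₁ ++ E₂) ++ eqGadget (a + (m + k)) u v) (3 + (a + (m + k)))
eq-rep {f = f} {g = g} T₁ T₂ = record
  { ref-in  = InInterval-fresh (<ᵇ⇒< 3 4 _)
  ; vars-in = ≐-VarsIn
  ; total   = λ ν → Attains⇒Solvable (≐⁺ (evaluates T₁ ν) (evaluates T₂ ν))
  ; correct = λ ν → (λ f≡g → subst (Attains _ _ ν) (slack≡0 f≡g)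
                                     (≐⁺ (evaluates T₁ ν) (evaluates T₂ ν)))
                  , (λ h → let (_ , A , B) = ≐⁻ h in trans (sym (unique T₁ A)) (unique T₂ B))
  }
  where
  open Juxtaposed (vars-in T₁) (ref-in T₁) (vars-in T₂) (ref-in T₂)
  slack≡0 : x ≡ y → (y ∸ x) + (x ∸ y) ≡ 0
  slack≡0 {x} refl = cong₂ _+_ (n∸n≡0 x) (n∸n≡0 x)

bindParam : ℕ → Constr → Constr
bindParam z (ecst u n)       = ecst u n
bindParam z (evar u v)       = evar u v
bindParam z (epar u zero)    = evar u z
bindParam z (epar u (suc i)) = epar u i
bindParam z (eadd u v w)     = eadd u v w
bindParam z (emul u v w)     = emul u v w

bindParam-sem : ∀ z c → ⟦ bindParam z c ⟧ᶜ φ ν ≡ ⟦ c ⟧ᶜ φ (φ z · ν)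
bindParam-sem z (ecst _ _)       = refl
bindParam-sem z (evar _ _)       = refl
bindParam-sem z (epar _ zero)    = refl
bindParam-sem z (epar _ (suc _)) = refl
bindParam-sem z (eadd _ _ _)     = refl
bindParam-sem z (emul _ _ _)     = refl

InInterval-suc : InInterval (suc a) n u → InInterval a (suc n) u
InInterval-suc {a} {n} = InInterval-⊆ (n≤1+n a) (≤-reflexive (sym (+-suc a n)))

bindParam-VarsIn : VarsIn (suc a) n c → VarsIn a (suc n) (bindParam a c)
bindParam-VarsIn {a = a} {n = n} {c = c} = go c
  where
  lift : InInterval (suc a) n u → InInterval a (suc n) u
  lift = InInterval-suc
  go : ∀ c → VarsIn (suc a) n c → VarsIn a (suc n) (bindParam a c)
  go (ecst _ _)       u∈             = lift u∈
  go (evar _ _)       (u∈ , v∈)      = lift u∈ , lift v∈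
  go (epar _ zero)    u∈             = lift u∈ , ≤-refl , m<m+n a z<s
  go (epar _ (suc _)) u∈             = lift u∈
  go (eadd _ _ _)     (u∈ , v∈ , w∈) = lift u∈ , lift v∈ , lift w∈
  go (emul _ _ _)     (u∈ , v∈ , w∈) = lift u∈ , lift v∈ , lift w∈

Attains-bindParam⁺ : All (VarsIn (suc a) n) E → InInterval (suc a) n r →
                     Attains E r (k · ν) x → Attains (map (bindParam a) E) r ν x
Attains-bindParam⁺ {a = a} {E = E} {k = k} {ν = ν} E∈ (a<r , _) (φ , φr , h) =
  χ , trans (glue-≥ _ φ a<r) φr ,
  map⁺ (All.map (λ {c} → subst id (sym (bindParam-sem a c))) h′)
  where
  χ = glue (suc a) (λ _ → k) φ
  h′ : ⟦ E ⟧ᴱ χ (χ a · ν)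
  h′ = subst (λ j → ⟦ E ⟧ᴱ χ (j · ν)) (sym (glue-< {b = suc a} _ φ ≤-refl)) (⟦⟧ᴱ-glueʳ _ E∈ h)

Attains-bindParam⁻ : ∀ E → Attains (map (bindParam z) E) r ν x → ∃ λ k → Attains E r (k · ν) x
Attains-bindParam⁻ {z = z} E (φ , φr , h) =
  φ z , φ , φr , All.map (λ {c} → subst id (bindParam-sem z c)) (map⁻ h)

ex-rep : ElemRep R (suc a) n E r → ElemRep (λ ν → ∃ λ k → R (k · ν)) a (suc n) (map (bindParam a) E) r
ex-rep {a = a} {E = E} {r = r} I = record
  { ref-in  = InInterval-suc (ref-in I)
  ; vars-in = map⁺ (All.map bindParam-VarsIn (vars-in I))
  ; total   = λ ν → Attains⇒Solvable (bind (proj₂ (ElemRep-attains I (0 · ν))))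
  ; correct = λ ν → (λ (k , p) → bind (ElemRep-complete I p))
                  , (λ h → let (k , A) = Attains-bindParam⁻ E h in k , ElemRep-sound I A)
  }
  where
  bind : Attains E r (k · ν) x → Attains (map (bindParam a) E) r ν x
  bind = Attains-bindParam⁺ (vars-in I) (ref-in I)

≤-*-suc : ∀ l s → m ≤ suc l * s → suc m ≤ suc l * suc s
≤-*-suc l s m≤ =
  ≤-trans (+-mono-≤ (s≤s (z≤n {l})) m≤) (≤-reflexive (sym (*-suc (suc l) s)))

≤-+-*-suc : ∀ l s t → m ≤ suc l * s → k ≤ suc l * t → m + k + 1 ≤ suc l * suc (s + t)
≤-+-*-suc {m = m} {k = k} l s t m≤ k≤ =
  subst (_≤ suc l * suc (s + t)) (+-comm 1 (m + k))
    (≤-*-suc l (s + t)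
      (≤-trans (+-mono-≤ m≤ k≤) (≤-reflexive (sym (*-distribˡ-+ (suc l) s t)))))

lemma3p3 : (a : ℕ) (A : Form) →
    Σ ℕ λ n → n ≤ 8 * size A ×
      Σ (List Constr) λ E → Σ ℕ λ r → ElemRep ⟦ A ⟧ a n E r
lemma3p3 a (cst i k)   = 6 , m≤m+n 6 2 , _ , _ , eq-rep (param-term a i) (const-term (a + 1) k)
lemma3p3 a (eqv i j)   = 6 , m≤m+n 6 2 , _ , _ , eq-rep (param-term a i) (param-term (a + 1) j)
lemma3p3 a (add i j k) = 8 , ≤-refl , _ , _ ,
  eq-rep (param-term a i) (op-term plus (param-term (a + 1) j) (param-term (a + 1 + 1) k))
lemma3p3 a (mul i j k) = 8 , ≤-refl , _ , _ ,
  eq-rep (param-term a i) (op-term times (param-term (a + 1) j) (param-term (a + 1 + 1) k))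
lemma3p3 a (conj A B) =
  let (m , m≤ , _ , _ , IA) = lemma3p3 a A
      (k , k≤ , _ , _ , IB) = lemma3p3 (a + m) B
  in m + k + 1 , ≤-+-*-suc 7 (size A) (size B) m≤ k≤ , _ , _ , conj-rep IA IB
lemma3p3 a (disj A B) =
  let (m , m≤ , _ , _ , IA) = lemma3p3 a A
      (k , k≤ , _ , _ , IB) = lemma3p3 (a + m) B
  in m + k + 1 , ≤-+-*-suc 7 (size A) (size B) m≤ k≤ , _ , _ , disj-rep IA IB
lemma3p3 a (ex A) =
  let (n , n≤ , _ , _ , I) = lemma3p3 (suc a) A
  in suc n , ≤-*-suc 7 (size A) n≤ , _ , _ , ex-rep I
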